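{- Let $q$ be a prime power, let $\ell\ge 2$ and $m\ge\ell$ be integers, and let $\alpha=(\alpha_1,\dots,\alpha_\ell)\in I(\ell,m)$. Then $$\sum_{\beta\in\nabla(\alpha)} q^{\beta_1+\dots+\beta_\ell} < \left(\frac{q}{q-1}\right)^{\ell} q^{\alpha_1+\dots+\alpha_\ell}.$$
   Context: $I(\ell,m)=\{(\beta_1,\dots,\beta_\ell)\in\mathbb{Z}^\ell: 1\le\beta_1<\dots<\beta_\ell\le m\}$, and $\nabla(\alpha)=\{\beta\in I(\ell,m): \beta_i\le\alpha_i \text{ for all } i\}$. -}

module Defs where

open import Data.Nat using (ℕ; zero; suc; _+_; _*_; _^_; _≤_; _<_; _≤?_; _<?_)
open import Data.Nat.Primality using (Prime)
open import Data.Product using (Σ; ∃; _×_; _,_)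
open import Data.Product.Properties using ()
open import Relation.Nullary.Decidable using (Dec; yes; no; _×-dec_)
open import Data.Vec using (Vec; []; _∷_)
open import Data.Vec.Relation.Unary.All using (All; all?)
open import Data.Vec.Relation.Binary.Pointwise.Inductive using (Pointwise) renaming (decidable to pw-dec)
open import Data.List using (List; []; _∷_; map; concatMap; upTo; filter)
open import Data.Nat.ListAction using (sum)
open import Relation.Binary.PropositionalEquality using (_≡_)

IsPrimePower : ℕ → Set
IsPrimePower q = Σ ℕ λ p → Σ ℕ λ k → Prime p × 1 ≤ k × q ≡ p ^ k

data StrictlyIncreasing : ∀ {n} → Vec ℕ n → Set where
  []  : StrictlyIncreasing []
  [_] : ∀ x → StrictlyIncreasing (x ∷ [])
  cons : ∀ {n} x y (xs : Vec ℕ n) → x < y → StrictlyIncreasing (y ∷ xs) →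
         StrictlyIncreasing (x ∷ y ∷ xs)

strictlyIncreasing? : ∀ {n} (v : Vec ℕ n) → Dec (StrictlyIncreasing v)
strictlyIncreasing? [] = yes []
strictlyIncreasing? (x ∷ []) = yes [ x ]
strictlyIncreasing? (x ∷ y ∷ xs) with x <? y | strictlyIncreasing? (y ∷ xs)
... | yes p | yes q = yes (cons x y xs p q)
... | no ¬p | _ = no λ { (cons _ _ _ p _) → ¬p p }
... | yes _ | no ¬q = no λ { (cons _ _ _ _ q) → ¬q q }

InRange : ℕ → ℕ → Set
InRange m x = 1 ≤ x × x ≤ m

inRange? : ∀ m x → Dec (InRange m x)
inRange? m x = (1 ≤? x) ×-dec (x ≤? m)

-- I(ℓ,m) = { β ∈ ℤ^ℓ : 1 ≤ β₁ < ⋯ < β_ℓ ≤ m }  (entries in ℕ suffice since β₁ ≥ 1)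
I : (ℓ m : ℕ) → Vec ℕ ℓ → Set
I ℓ m β = StrictlyIncreasing β × All (InRange m) β

I? : ∀ ℓ m (β : Vec ℕ ℓ) → Dec (I ℓ m β)
I? ℓ m β = strictlyIncreasing? β ×-dec all? (inRange? m) β

allVecs : (ℓ m : ℕ) → List (Vec ℕ ℓ)
allVecs zero m = [] ∷ []
allVecs (suc ℓ) m = concatMap (λ x → map (x ∷_) (allVecs ℓ m)) (map suc (upTo m))

-- ∇(α) = { β ∈ I(ℓ,m) : βᵢ ≤ αᵢ for all i }, as an explicit duplicate-free list
∇ : ∀ ℓ m → Vec ℕ ℓ → List (Vec ℕ ℓ)
∇ ℓ m α = filter (λ β → I? ℓ m β ×-dec pw-dec _≤?_ β α) (allVecs ℓ m)

vsum : ∀ {n} → Vec ℕ n → ℕ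
vsum [] = 0
vsum (x ∷ xs) = x + vsum xs

nablaSum : (q ℓ m : ℕ) → Vec ℕ ℓ → ℕ
nablaSum q ℓ m α = sum (map (λ β → q ^ vsum β) (∇ ℓ m α))

{-# OPTIONS --safe #-}
-- Dropping the monotonicity condition enlarges ∇(α) to the box of all
-- β ∈ {1,…,m}^ℓ with βᵢ ≤ αᵢ, and over the box the sum factorises as
-- ∏ᵢ Σ_{1 ≤ x ≤ min(m,αᵢ)} q^x.  Each factor obeys the geometric identity
-- (q-1)·Σ_{x=1}^{k} q^x + q = q^{k+1} ≤ q^{αᵢ+1}, so (q-1) times it is strictly
-- below q^{αᵢ+1}; multiplying ℓ ≥ 1 such bounds gives the claim.  The lemmas
-- write q as suc r, so that q ∸ 1 is r.
module Submission where

open import Defs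
open import Data.Nat using (ℕ; zero; suc; _+_; _*_; _^_; _∸_; _⊓_; _≤_; _<_; _≤?_; s≤s; z<s)
open import Data.Nat.Properties
open import Data.Nat.Primality using (Prime; ¬prime[0])
open import Data.Nat.ListAction using (sum)
open import Data.Nat.ListAction.Properties using (sum-++)
open import Data.Nat.Solver using (module +-*-Solver)
open import Data.List using (List; []; _∷_; _∷ʳ_; _++_; map; concatMap; filter; upTo)
open import Data.List.Properties using (map-++; map-∘; map-cong; upTo-∷ʳ)
open import Data.Vec using (Vec; []; _∷_)
open import Data.Vec.Relation.Binary.Pointwise.Inductive using (Pointwise; []; _∷_)
open import Data.Product using (_,_)
open import Data.Sum using (inj₁; inj₂)
open import Data.Empty using (⊥-elim)
open import Relation.Nullary using (¬_; yes; no; contradiction)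
open import Relation.Unary using (Decidable)
open import Relation.Binary.PropositionalEquality using (_≡_; refl; sym; trans; cong; subst; module ≡-Reasoning)

sum-filter-≤ : ∀ {A : Set} {P : A → Set} (P? : Decidable P) {f g : A → ℕ} →
  (∀ x → P x → f x ≤ g x) → ∀ xs → sum (map f (filter P? xs)) ≤ sum (map g xs)
sum-filter-≤ P? f≤g [] = ≤-refl
sum-filter-≤ P? f≤g (x ∷ xs) with P? x
... | yes px = +-mono-≤ (f≤g x px) (sum-filter-≤ P? f≤g xs)
... | no  _  = ≤-trans (sum-filter-≤ P? f≤g xs) (m≤n+m _ _)

sum-map-concatMap : ∀ {A B : Set} (f : B → ℕ) (g : A → List B) xs →
  sum (map f (concatMap g xs)) ≡ sum (map (λ x → sum (map f (g x))) xs)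
sum-map-concatMap f g [] = refl
sum-map-concatMap f g (x ∷ xs) = begin
  sum (map f (g x ++ concatMap g xs))              ≡⟨ cong sum (map-++ f (g x) (concatMap g xs)) ⟩
  sum (map f (g x) ++ map f (concatMap g xs))      ≡⟨ sum-++ (map f (g x)) _ ⟩
  sum (map f (g x)) + sum (map f (concatMap g xs)) ≡⟨ cong (sum (map f (g x)) +_) (sum-map-concatMap f g xs) ⟩
  sum (map f (g x)) + sum (map (λ y → sum (map f (g y))) xs) ∎
  where open ≡-Reasoning

sum-map-*ˡ : ∀ {A : Set} (c : ℕ) (f : A → ℕ) xs → sum (map (λ x → c * f x) xs) ≡ c * sum (map f xs)
sum-map-*ˡ c f [] = sym (*-zeroʳ c)
sum-map-*ˡ c f (x ∷ xs) =
  trans (cong (c * f x +_) (sum-map-*ˡ c f xs)) (sym (*-distribˡ-+ c (f x) (sum (map f xs))))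

sum-map-*ʳ : ∀ {A : Set} (c : ℕ) (f : A → ℕ) xs → sum (map (λ x → f x * c) xs) ≡ sum (map f xs) * c
sum-map-*ʳ c f [] = refl
sum-map-*ʳ c f (x ∷ xs) =
  trans (cong (f x * c +_) (sum-map-*ʳ c f xs)) (sym (*-distribʳ-+ c (f x) (sum (map f xs))))

sum-map-∷ʳ : ∀ {A : Set} (f : A → ℕ) xs x → sum (map f (xs ∷ʳ x)) ≡ sum (map f xs) + f x
sum-map-∷ʳ f xs x = begin
  sum (map f (xs ∷ʳ x))           ≡⟨ cong sum (map-++ f xs (x ∷ [])) ⟩
  sum (map f xs ∷ʳ f x)           ≡⟨ sum-++ (map f xs) (f x ∷ []) ⟩
  sum (map f xs) + (f x + 0)      ≡⟨ cong (sum (map f xs) +_) (+-identityʳ (f x)) ⟩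
  sum (map f xs) + f x            ∎
  where open ≡-Reasoning

¬isPrimePower[0] : ¬ IsPrimePower 0
¬isPrimePower[0] (p , k , p-prime , _ , 0≡p^k) =
  ¬prime[0] (subst Prime (m^n≡0⇒m≡0 p k (sym 0≡p^k)) p-prime)

cutoffPow : ℕ → ℕ → ℕ → ℕ
cutoffPow q a x with x ≤? a
... | yes _ = q ^ x
... | no  _ = 0

cutoffPow-≤ : ∀ q {a x} → x ≤ a → cutoffPow q a x ≡ q ^ x
cutoffPow-≤ q {a} {x} x≤a with x ≤? a
... | yes _   = refl
... | no  x≰a = contradiction x≤a x≰a

cutoffPow-> : ∀ q {a x} → a < x → cutoffPow q a x ≡ 0
cutoffPow-> q {a} {x} a<x with x ≤? a
... | yes x≤a = contradiction x≤a (<⇒≱ a<x)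
... | no  _   = refl

cutoffGeomSum : ℕ → ℕ → ℕ → ℕ
cutoffGeomSum q a m = sum (map (cutoffPow q a) (map suc (upTo m)))

cutoffGeomSum-suc : ∀ q a m → cutoffGeomSum q a (suc m) ≡ cutoffGeomSum q a m + cutoffPow q a (suc m)
cutoffGeomSum-suc q a m = begin
  sum (map (cutoffPow q a) (map suc (upTo (suc m))))
    ≡⟨ cong (λ xs → sum (map (cutoffPow q a) (map suc xs))) (sym (upTo-∷ʳ m)) ⟩
  sum (map (cutoffPow q a) (map suc (upTo m ∷ʳ m)))
    ≡⟨ cong (λ xs → sum (map (cutoffPow q a) xs)) (map-++ suc (upTo m) (m ∷ [])) ⟩
  sum (map (cutoffPow q a) (map suc (upTo m) ∷ʳ suc m))
    ≡⟨ sum-map-∷ʳ (cutoffPow q a) (map suc (upTo m)) (suc m) ⟩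
  cutoffGeomSum q a m + cutoffPow q a (suc m) ∎
  where open ≡-Reasoning

cutoffGeomSum-closed : ∀ r a m → cutoffGeomSum (suc r) a m * r + suc r ≡ suc r ^ suc (m ⊓ a)
cutoffGeomSum-closed r a zero = sym (*-identityʳ (suc r))
cutoffGeomSum-closed r a (suc m) with ≤-<-connex (suc m) a
... | inj₁ m<a = begin
  cutoffGeomSum q a (suc m) * r + q    ≡⟨ cong (λ s → s * r + q) (cutoffGeomSum-suc q a m) ⟩
  (S + cutoffPow q a (suc m)) * r + q  ≡⟨ cong (λ c → (S + c) * r + q) (cutoffPow-≤ q m<a) ⟩
  (S + q ^ suc m) * r + q              ≡⟨ solve 4 (λ S e r q → (S :+ e) :* r :+ q := (S :* r :+ q) :+ r :* e) refl S (q ^ suc m) r q ⟩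
  (S * r + q) + r * q ^ suc m          ≡⟨ cong (_+ r * q ^ suc m) (cutoffGeomSum-closed r a m) ⟩
  q ^ suc (m ⊓ a) + r * q ^ suc m      ≡⟨ cong (λ k → q ^ suc k + r * q ^ suc m) (m≤n⇒m⊓n≡m (<⇒≤ m<a)) ⟩
  q ^ suc (suc m)                      ≡⟨ cong (λ k → q ^ suc k) (sym (m≤n⇒m⊓n≡m m<a)) ⟩
  q ^ suc (suc m ⊓ a)                  ∎
  where
  open ≡-Reasoning
  open +-*-Solver
  q = suc r
  S = cutoffGeomSum q a m
... | inj₂ a<1+m = begin
  cutoffGeomSum q a (suc m) * r + q    ≡⟨ cong (λ s → s * r + q) (cutoffGeomSum-suc q a m) ⟩
  (S + cutoffPow q a (suc m)) * r + q  ≡⟨ cong (λ c → (S + c) * r + q) (cutoffPow-> q a<1+m) ⟩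
  (S + 0) * r + q                      ≡⟨ cong (λ s → s * r + q) (+-identityʳ S) ⟩
  S * r + q                            ≡⟨ cutoffGeomSum-closed r a m ⟩
  q ^ suc (m ⊓ a)                      ≡⟨ cong (λ k → q ^ suc k) (m≥n⇒m⊓n≡n (≤-pred a<1+m)) ⟩
  q ^ suc a                            ≡⟨ cong (λ k → q ^ suc k) (sym (m≥n⇒m⊓n≡n (<⇒≤ a<1+m))) ⟩
  q ^ suc (suc m ⊓ a)                  ∎
  where
  open ≡-Reasoning
  q = suc r
  S = cutoffGeomSum q a m

cutoffGeomSum-bound : ∀ r a m → cutoffGeomSum (suc r) a m * r < suc r ^ suc a
cutoffGeomSum-bound r a m = begin-strict
  cutoffGeomSum (suc r) a m * r          <⟨ m<m+n _ z<s ⟩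
  cutoffGeomSum (suc r) a m * r + suc r  ≡⟨ cutoffGeomSum-closed r a m ⟩
  suc r ^ suc (m ⊓ a)                    ≤⟨ ^-monoʳ-≤ (suc r) (s≤s (m⊓n≤n m a)) ⟩
  suc r ^ suc a                          ∎
  where open ≤-Reasoning

boxPow : ℕ → ∀ {ℓ} → Vec ℕ ℓ → Vec ℕ ℓ → ℕ
boxPow q []      []      = 1
boxPow q (a ∷ α) (x ∷ β) = cutoffPow q a x * boxPow q α β

boxSum : ℕ → ℕ → ∀ {ℓ} → Vec ℕ ℓ → ℕ
boxSum q m {ℓ} α = sum (map (boxPow q α) (allVecs ℓ m))

^-vsum≤boxPow : ∀ q {ℓ} {α β : Vec ℕ ℓ} → Pointwise _≤_ β α → q ^ vsum β ≤ boxPow q α β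
^-vsum≤boxPow q [] = ≤-refl
^-vsum≤boxPow q {α = a ∷ α} {x ∷ β} (x≤a ∷ β≤α) = begin
  q ^ (x + vsum β)          ≡⟨ ^-distribˡ-+-* q x (vsum β) ⟩
  q ^ x * q ^ vsum β        ≤⟨ *-monoʳ-≤ (q ^ x) (^-vsum≤boxPow q β≤α) ⟩
  q ^ x * boxPow q α β      ≡⟨ cong (_* boxPow q α β) (sym (cutoffPow-≤ q x≤a)) ⟩
  boxPow q (a ∷ α) (x ∷ β)  ∎
  where open ≤-Reasoning

nablaSum≤boxSum : ∀ q m {ℓ} (α : Vec ℕ ℓ) → nablaSum q ℓ m α ≤ boxSum q m α
nablaSum≤boxSum q m {ℓ} α = sum-filter-≤ _ (λ β (_ , β≤α) → ^-vsum≤boxPow q β≤α) (allVecs ℓ m)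

boxSum-∷ : ∀ q m {ℓ} a (α : Vec ℕ ℓ) → boxSum q m (a ∷ α) ≡ cutoffGeomSum q a m * boxSum q m α
boxSum-∷ q m {ℓ} a α = begin
  sum (map (boxPow q (a ∷ α)) (concatMap (λ x → map (x ∷_) (allVecs ℓ m)) (map suc (upTo m))))
    ≡⟨ sum-map-concatMap (boxPow q (a ∷ α)) (λ x → map (x ∷_) (allVecs ℓ m)) (map suc (upTo m)) ⟩
  sum (map (λ x → sum (map (boxPow q (a ∷ α)) (map (x ∷_) (allVecs ℓ m)))) (map suc (upTo m)))
    ≡⟨ cong sum (map-cong row (map suc (upTo m))) ⟩
  sum (map (λ x → cutoffPow q a x * boxSum q m α) (map suc (upTo m)))
    ≡⟨ sum-map-*ʳ (boxSum q m α) (cutoffPow q a) (map suc (upTo m)) ⟩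
  cutoffGeomSum q a m * boxSum q m α ∎
  where
  open ≡-Reasoning
  row : ∀ x → sum (map (boxPow q (a ∷ α)) (map (x ∷_) (allVecs ℓ m))) ≡ cutoffPow q a x * boxSum q m α
  row x = trans (cong sum (sym (map-∘ (allVecs ℓ m))))
                (sum-map-*ˡ (cutoffPow q a x) (boxPow q α) (allVecs ℓ m))

mutual
  boxSum-bound : ∀ r m {ℓ} (α : Vec ℕ ℓ) → boxSum (suc r) m α * r ^ ℓ ≤ suc r ^ ℓ * suc r ^ vsum α
  boxSum-bound r m []      = ≤-refl
  boxSum-bound r m (a ∷ α) = <⇒≤ (boxSum-bound-strict r m a α)

  boxSum-bound-strict : ∀ r m {ℓ} a (α : Vec ℕ ℓ) →
    boxSum (suc r) m (a ∷ α) * r ^ suc ℓ < suc r ^ suc ℓ * suc r ^ vsum (a ∷ α)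
  boxSum-bound-strict r m {ℓ} a α = begin-strict
    boxSum q m (a ∷ α) * r ^ suc ℓ      ≡⟨ cong (_* r ^ suc ℓ) (boxSum-∷ q m a α) ⟩
    G * B * (r * r ^ ℓ)                 ≡⟨ [m*n]*[o*p]≡[m*o]*[n*p] G B r (r ^ ℓ) ⟩
    G * r * (B * r ^ ℓ)                 ≤⟨ *-monoʳ-≤ (G * r) (boxSum-bound r m α) ⟩
    G * r * V                           <⟨ *-monoˡ-< V {{V≢0}} (cutoffGeomSum-bound r a m) ⟩
    q ^ suc a * (q ^ ℓ * q ^ vsum α)    ≡⟨ [m*n]*[o*p]≡[m*o]*[n*p] q (q ^ a) (q ^ ℓ) (q ^ vsum α) ⟩
    q ^ suc ℓ * (q ^ a * q ^ vsum α)    ≡⟨ cong (q ^ suc ℓ *_) (sym (^-distribˡ-+-* q a (vsum α))) ⟩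
    q ^ suc ℓ * q ^ (a + vsum α)        ∎
    where
    open ≤-Reasoning
    q = suc r
    G = cutoffGeomSum q a m
    B = boxSum q m α
    V = q ^ ℓ * q ^ vsum α
    V≢0 = m*n≢0 (q ^ ℓ) (q ^ vsum α) {{m^n≢0 q ℓ}} {{m^n≢0 q (vsum α)}}

lemma3p5 : (q ℓ m : ℕ) → IsPrimePower q → 2 ≤ ℓ → ℓ ≤ m →
    (α : Vec ℕ ℓ) → I ℓ m α →
    nablaSum q ℓ m α * (q ∸ 1) ^ ℓ < q ^ ℓ * q ^ vsum α
lemma3p5 zero    _       _ q-pp _       _ _       _ = ⊥-elim (¬isPrimePower[0] q-pp)
lemma3p5 (suc r) (suc ℓ) m _    (s≤s _) _ (a ∷ α) _ =
  ≤-<-trans (*-monoˡ-≤ (r ^ suc ℓ) (nablaSum≤boxSum (suc r) m (a ∷ α)))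
            (boxSum-bound-strict r m a α)
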